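{- Fix a positive integer $k$. For all integers $n>1$ and all integers $m,\ell$, $$p_{n,m,\ell}=p_{n-1,m,\ell}+p_{n-(2k+2),m-1,\ell}+p_{n-(k+2),\ell,m-1}.$$
   Context: The $k$-Skipponacci numbers: $S^{(k)}_n=0$ for $n\le0$, $S^{(k)}_i=i$ for $1\le i\le k+1$, $S^{(k)}_{n+1}=S^{(k)}_n+S^{(k)}_{n-k}$ for $n\ge k+1$. Every integer has a unique far-difference representation $x=\sum_t\epsilon_tS^{(k)}_{n_t}$ ($\epsilon_t\in\{\pm1\}$, distinct indices $n_t\ge1$) with same-sign terms at least $2k+2$ apart in index and opposite-sign terms at least $k+2$ apart. $R_k(n)=S^{(k)}_n+S^{(k)}_{n-2k-2}+S^{(k)}_{n-4k-4}+\cdots$ (positive indices only) for $n>0$, $R_k(n)=0$ for $n\le 0$. For $n\ge1$, $p_{n,m,\ell}$ is the number of integers in $(R_k(n-1),R_k(n)]$ whose far-difference representation has exactly $m$ positive summands and exactly $\ell$ negative summands; $p_{n,m,\ell}=0$ for $n\le 0$. -}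

module Defs where

open import Data.Nat using (ℕ; zero; suc; _+_; _∸_; _≤_; _≤?_; ∣_-_∣)
open import Data.Integer as ℤ using (ℤ; +_; -[1+_])
open import Data.Bool using (Bool; true; false; if_then_else_)
open import Data.List using (List; []; _∷_; length; filter)
open import Data.List.Relation.Unary.All using (All)
open import Data.List.Relation.Unary.AllPairs using (AllPairs)
open import Data.Product using (_×_; _,_; Σ; proj₁; proj₂)
open import Relation.Nullary using (¬_; Dec; yes; no)
open import Relation.Nullary.Decidable using (⌊_⌋)
open import Relation.Binary.PropositionalEquality using (_≡_)

-- k-Skipponacci numbers  S^{(k)}_n  (n : ℕ; S^{(k)}_0 = 0)
--   S_i = i for 0 ≤ i ≤ k+1,  S_n = S_{n-1} + S_{n-1-k} for n ≥ k+2.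
-- Defined with fuel (fuel ≥ n suffices since arguments strictly decrease).

Sfuel : ℕ → ℕ → ℕ → ℕ
Sfuel zero    k n = 0
Sfuel (suc f) k n with n ≤? suc k
... | yes _ = n
... | no  _ = Sfuel f k (n ∸ 1) + Sfuel f k (n ∸ 1 ∸ k)

S : ℕ → ℕ → ℕ
S k n = Sfuel n k n

-- R_k(n) = S_n + S_{n-2k-2} + S_{n-4k-4} + ...  (positive indices only),
-- R_k(0) = 0.

Rfuel : ℕ → ℕ → ℕ → ℕ
Rfuel zero    k n       = 0
Rfuel (suc f) k zero    = 0
Rfuel (suc f) k (suc n) = S k (suc n) + Rfuel f k (suc n ∸ (2 + 2 * k))
  where open import Data.Nat using (_*_)

R : ℕ → ℕ → ℕ
R k n = Rfuel n k n

-- Signed summands: (true , i) stands for +S_i, (false , i) for -S_i.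

Term : Set
Term = Bool × ℕ

Apart : ℕ → Term → Term → Set
Apart k (s , i) (t , j) with s Data.Bool.≟ t
  where import Data.Bool
... | yes _ = 2 + (k + k) ≤ ∣ i - j ∣
... | no  _ = 2 + k ≤ ∣ i - j ∣

-- far-difference representation condition: indices ≥ 1, pairwise gaps
-- (distinctness of indices follows from the gaps, which are ≥ k+2 ≥ 2)
FarDiff : ℕ → List Term → Set
FarDiff k L = All (λ t → 1 ≤ proj₂ t) L × AllPairs (Apart k) L

value : ℕ → List Term → ℤ
value k []               = + 0
value k ((true  , i) ∷ L) = + S k i ℤ.+ value k L
value k ((false , i) ∷ L) = ℤ.- (+ S k i) ℤ.+ value k L

npos : List Term → ℕ
npos L = length (filter (λ t → Data.Bool._≟_ (proj₁ t) true) L)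
  where import Data.Bool

nneg : List Term → ℕ
nneg L = length (filter (λ t → Data.Bool._≟_ (proj₁ t) false) L)
  where import Data.Bool

-- x has a far-difference representation with exactly m positive and
-- ℓ negative summands (by uniqueness: "its" far-difference representation)
HasFDR : ℕ → ℤ → ℤ → ℤ → Set
HasFDR k x m ℓ = Σ (List Term) λ L →
  FarDiff k L × value k L ≡ x × + npos L ≡ m × + nneg L ≡ ℓ

-- Count P a len c : exactly c of the integers a+1, ..., a+len satisfy P.

data Count (P : ℤ → Set) (a : ℤ) : ℕ → ℕ → Set where
  cnil : Count P a 0 0
  cyes : ∀ {len c} → Count P a len c → P (a ℤ.+ + suc len) →
         Count P a (suc len) (suc c)
  cno  : ∀ {len c} → Count P a len c → ¬ P (a ℤ.+ + suc len) →
         Count P a (suc len) c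

-- IsP k n m ℓ c :  p_{n,m,ℓ} = c  (for the k-Skipponacci numbers).
-- For n ≤ 0, p = 0; for n = j+1 ≥ 1, c counts integers in (R_k(j), R_k(j+1)]
-- whose far-difference representation has m positive, ℓ negative summands.
IsP : ℕ → ℤ → ℤ → ℤ → ℕ → Set
IsP k (+ zero)    m ℓ c = c ≡ 0
IsP k -[1+ _ ]    m ℓ c = c ≡ 0
IsP k (+ suc j)   m ℓ c =
  Count (λ x → HasFDR k x m ℓ) (+ R k j) (R k (suc j) ∸ R k j) c

-- Idea: by the identity S_n = R_k(n-1) + R_k(n-k-2) + 1, an integer x lies in the
-- window (R_k(n-1), R_k(n)] exactly when x = S_n + v with -R_k(n-k-2) ≤ v ≤
-- R_k(n-2k-2), and then the representations of x are exactly +S_n followed by a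
-- representation of v.  This greedy step rests on a value bound: the value of a
-- representation lies in the window of its largest summand.  Splitting the range
-- of v at -R_k(q-1) and R_k(p-1) (q = n-k-2, p = n-2k-2) cuts the window into
-- three blocks, matched with the windows of level q (negated, which swaps the
-- roles of m-1 and ℓ), of level n-1 (via x ↦ x - S_n + S_{n-1}) and of level p.
module Submission where

open import Defs
open import Data.Nat using (ℕ)

module Skipponacci (k : ℕ) where

  open import Data.Nat
  open import Data.Nat.Properties
  open import Data.Nat.Induction using (<-rec)
  open import Data.Nat.Tactic.RingSolver using (solve-∀)
  open import Data.Empty using (⊥-elim)
  open import Data.Product using (_,_)
  open import Relation.Nullary using (¬_; yes; no)
  open import Relation.Binary.PropositionalEquality

  -- The index gaps of the far-difference condition: same-sign summands are
  -- at least 'wide' apart, opposite-sign summands at least 'narrow' apart.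
  wide narrow : ℕ
  wide   = 2 + 2 * k
  narrow = 2 + k

  wide≡ : wide ≡ suc k + suc k
  wide≡ = trans (cong (λ z → 2 + (k + z)) (+-identityʳ k)) (cong suc (sym (+-suc k k)))

  Sfuel-zero : ∀ f → Sfuel f k 0 ≡ 0
  Sfuel-zero zero = refl
  Sfuel-zero (suc f) with 0 ≤? suc k
  ... | yes _ = refl
  ... | no 0≰ = ⊥-elim (0≰ z≤n)

  Sfuel-irrelevant : ∀ f g n → n ≤ f → n ≤ g → Sfuel f k n ≡ Sfuel g k n
  Sfuel-irrelevant zero g .0 z≤n _ = sym (Sfuel-zero g)
  Sfuel-irrelevant (suc f) zero .0 _ z≤n = Sfuel-zero (suc f)
  Sfuel-irrelevant (suc f) (suc g) n n≤f n≤g with n ≤? suc k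
  ... | yes _ = refl
  ... | no _ = cong₂ _+_ (Sfuel-irrelevant f g (n ∸ 1) (pred-≤ n≤f) (pred-≤ n≤g))
                         (Sfuel-irrelevant f g (n ∸ 1 ∸ k) (pred-∸-≤ n≤f) (pred-∸-≤ n≤g))
    where
      pred-≤ : ∀ {m} → n ≤ suc m → n ∸ 1 ≤ m
      pred-≤ = ∸-monoˡ-≤ 1
      pred-∸-≤ : ∀ {m} → n ≤ suc m → n ∸ 1 ∸ k ≤ m
      pred-∸-≤ p = ≤-trans (m∸n≤m (n ∸ 1) k) (pred-≤ p)

  S-small : ∀ n → n ≤ suc k → S k n ≡ n
  S-small zero _ = refl
  S-small (suc n) n≤ with suc n ≤? suc k
  ... | yes _ = refl
  ... | no n≰ = ⊥-elim (n≰ n≤)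

  Sfuel-step : ∀ f n → ¬ n ≤ suc k → Sfuel (suc f) k n ≡ Sfuel f k (n ∸ 1) + Sfuel f k (n ∸ 1 ∸ k)
  Sfuel-step f n n≰ with n ≤? suc k
  ... | yes n≤ = ⊥-elim (n≰ n≤)
  ... | no _ = refl

  S-rec : ∀ i → S k (suc (suc k + i)) ≡ S k (suc k + i) + S k (suc i)
  S-rec i = begin
      S k (suc (suc k + i))
    ≡⟨ Sfuel-step (suc k + i) (suc (suc k + i)) (λ le → 1+n≰n (≤-trans (m≤m+n (suc k) i) (≤-pred le))) ⟩
      S k (suc k + i) + Sfuel (suc k + i) k (suc k + i ∸ k)
    ≡⟨ cong (λ z → S k (suc k + i) + Sfuel (suc k + i) k z) shift ⟩
      S k (suc k + i) + Sfuel (suc k + i) k (suc i)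
    ≡⟨ cong (_+_ (S k (suc k + i))) (Sfuel-irrelevant _ _ (suc i) (s≤s (m≤n+m i k)) ≤-refl) ⟩
      S k (suc k + i) + S k (suc i) ∎
    where
      open ≡-Reasoning
      shift : suc k + i ∸ k ≡ suc i
      shift = trans (cong (_∸ k) (sym (+-suc k i))) (m+n∸m≡n k (suc i))

  Rfuel-irrelevant : ∀ f g n → n ≤ f → n ≤ g → Rfuel f k n ≡ Rfuel g k n
  Rfuel-irrelevant zero zero zero _ _ = refl
  Rfuel-irrelevant zero (suc g) zero _ _ = refl
  Rfuel-irrelevant (suc f) zero zero _ _ = refl
  Rfuel-irrelevant (suc f) (suc g) zero _ _ = refl
  Rfuel-irrelevant (suc f) (suc g) (suc n) (s≤s n≤f) (s≤s n≤g) =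
    cong (_+_ (S k (suc n))) (Rfuel-irrelevant f g (suc n ∸ wide) (≤-trans rest≤n n≤f) (≤-trans rest≤n n≤g))
    where rest≤n = m∸n≤m n (suc (2 * k))

  R-step : ∀ n → R k n ≡ S k n + R k (n ∸ wide)
  R-step zero = refl
  R-step (suc n) = cong (_+_ (S k (suc n))) (Rfuel-irrelevant n _ (suc n ∸ wide) (m∸n≤m n (suc (2 * k))) ≤-refl)

  R-small : ∀ j → j ≤ wide → R k j ≡ S k j
  R-small j j≤ = trans (R-step j) (trans (cong (λ z → S k j + R k z) (m≤n⇒m∸n≡0 j≤)) (+-identityʳ _))

  -- The basic identity  S_{j+1} = R_k(j) + R_k(j - (k+1)) + 1  (j ≥ 0); it says
  -- that the windows (R_k(j), R_k(j+1)] tile the positive integers.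
  Identity : ℕ → Set
  Identity j = S k (suc j) ≡ R k j + R k (j ∸ suc k) + 1

  -- The three cases: j ≤ k and k < j ≤ 2k+1 are checked directly (S_i = i there),
  -- and the case j ≥ 2k+2 reduces to j - (2k+2) by applying the recurrence twice.
  identity-low : ∀ j → j ≤ k → Identity j
  identity-low j j≤k = begin
      S k (suc j)             ≡⟨ S-small (suc j) (s≤s j≤k) ⟩
      suc j                   ≡⟨ +-comm 1 j ⟩
      j + 1                   ≡⟨ cong (_+ 1) (sym (+-identityʳ j)) ⟩
      j + 0 + 1               ≡⟨ cong₂ (λ u v → u + R k v + 1) (sym R≡j) (sym (m≤n⇒m∸n≡0 j≤sk)) ⟩
      R k j + R k (j ∸ suc k) + 1 ∎
    where
      open ≡-Reasoning
      j≤sk = ≤-trans j≤k (n≤1+n k)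
      R≡j : R k j ≡ j
      R≡j = trans (R-small j (≤-trans j≤sk (≤-trans (m≤m+n (suc k) (suc k)) (≤-reflexive (sym wide≡)))))
                  (S-small j j≤sk)

  identity-middle : ∀ i → i ≤ k → Identity (suc k + i)
  identity-middle i i≤k = begin
      S k (suc (suc k + i))             ≡⟨ S-rec i ⟩
      S k (suc k + i) + S k (suc i)     ≡⟨ cong₂ _+_ (sym (R-small (suc k + i) sk+i≤wide)) (S-small (suc i) (s≤s i≤k)) ⟩
      R k (suc k + i) + suc i           ≡⟨ cong (_+_ (R k (suc k + i))) (+-comm 1 i) ⟩
      R k (suc k + i) + (i + 1)         ≡⟨ sym (+-assoc (R k (suc k + i)) i 1) ⟩
      R k (suc k + i) + i + 1           ≡⟨ cong (λ v → R k (suc k + i) + v + 1) (sym R≡i) ⟩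
      R k (suc k + i) + R k (suc k + i ∸ suc k) + 1 ∎
    where
      open ≡-Reasoning
      i≤sk = ≤-trans i≤k (n≤1+n k)
      sk+i≤wide : suc k + i ≤ wide
      sk+i≤wide = ≤-trans (+-monoʳ-≤ (suc k) i≤sk) (≤-reflexive (sym wide≡))
      R≡i : R k (suc k + i ∸ suc k) ≡ i
      R≡i = trans (cong (R k) (m+n∸m≡n (suc k) i))
                  (trans (R-small i (≤-trans (m≤n+m i (suc k)) sk+i≤wide)) (S-small i i≤sk))

  identity-shift : ∀ i → Identity i → Identity (suc k + (suc k + i))
  identity-shift i ih = begin
      S k (suc (a + (a + i)))                 ≡⟨ S-rec (a + i) ⟩
      X + S k (suc (a + i))                   ≡⟨ cong (_+_ X) (S-rec i) ⟩
      X + (Y + S k (suc i))                   ≡⟨ cong (λ z → X + (Y + z)) ih ⟩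
      X + (Y + (R k i + R k (i ∸ a) + 1))     ≡⟨ regroup X Y (R k i) (R k (i ∸ a)) ⟩
      X + R k i + (Y + R k (i ∸ a)) + 1       ≡⟨ cong₂ (λ u v → u + v + 1) (sym outer) (sym inner) ⟩
      R k (a + (a + i)) + R k (a + (a + i) ∸ a) + 1 ∎
    where
      open ≡-Reasoning
      a = suc k
      X = S k (a + (a + i))
      Y = S k (a + i)
      regroup : ∀ x y r r′ → x + (y + (r + r′ + 1)) ≡ x + r + (y + r′) + 1
      regroup = solve-∀
      outer : R k (a + (a + i)) ≡ X + R k i
      outer = trans (R-step (a + (a + i)))
                    (cong (λ z → X + R k z) (trans (cong₂ _∸_ (sym (+-assoc a a i)) wide≡) (m+n∸m≡n (a + a) i)))
      inner : R k (a + (a + i) ∸ a) ≡ Y + R k (i ∸ a)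
      inner = trans (cong (R k) (m+n∸m≡n a (a + i)))
                    (trans (R-step (a + i)) (cong (λ z → Y + R k z) (trans (cong (a + i ∸_) wide≡) ([m+n]∸[m+o]≡n∸o a i a))))

  S-via-R : ∀ j → Identity j
  S-via-R = <-rec Identity by-range
    where
      by-range : ∀ j → (∀ {i} → i < j → Identity i) → Identity j
      by-range j rec with j ≤? k
      ... | yes j≤k = identity-low j j≤k
      ... | no j≰k with j ∸ suc k ≤? k
      ...   | yes i≤k = subst Identity (m+[n∸m]≡n (≰⇒> j≰k)) (identity-middle (j ∸ suc k) i≤k)
      ...   | no i≰k = subst Identity j≡ (identity-shift i (rec i<j))
        where
          i = j ∸ suc k ∸ suc k
          j≡ : suc k + (suc k + i) ≡ j
          j≡ = trans (cong (_+_ (suc k)) (m+[n∸m]≡n (≰⇒> i≰k))) (m+[n∸m]≡n (≰⇒> j≰k))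
          i<j : i < j
          i<j = ≤-trans (s≤s (≤-trans (m≤n+m i (suc k)) (m≤n+m (suc k + i) k))) (≤-reflexive j≡)

  R-suc : ∀ j → R k j < R k (suc j)
  R-suc j = begin-strict
      R k j                             <⟨ m<m+n (R k j) (m≤n+m 1 (R k (j ∸ suc k))) ⟩
      R k j + (R k (j ∸ suc k) + 1)     ≡⟨ sym (trans (S-via-R j) (+-assoc (R k j) _ 1)) ⟩
      S k (suc j)                       ≤⟨ m≤m+n (S k (suc j)) _ ⟩
      S k (suc j) + R k (suc j ∸ wide)  ≡⟨ sym (R-step (suc j)) ⟩
      R k (suc j)                       ∎
    where open ≤-Reasoning

  R-mono : ∀ {i j} → i ≤ j → R k i ≤ R k j
  R-mono {i} {j} i≤j with m≤n⇒∃[o]m+o≡n i≤j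
  ... | o , refl = go o
    where
      go : ∀ o → R k i ≤ R k (i + o)
      go zero = ≤-reflexive (cong (R k) (sym (+-identityʳ i)))
      go (suc o) = ≤-trans (go o) (≤-trans (<⇒≤ (R-suc (i + o))) (≤-reflexive (cong (R k) (sym (+-suc i o)))))

  R-cancel-< : ∀ {i j} → R k i < R k j → i < j
  R-cancel-< {i} {j} Ri<Rj with i <? j
  ... | yes i<j = i<j
  ... | no i≮j = ⊥-elim (<⇒≱ Ri<Rj (R-mono (≮⇒≥ i≮j)))

module Counting where

  open import Data.Nat as ℕ using (ℕ; suc)
  import Data.Nat.Properties as ℕP
  open import Data.Integer using (ℤ; +_; _+_; _-_; _<_; _≤_; +≤+; +<+)
  open import Data.Integer.Properties using (+-assoc; +-identityʳ; +-monoʳ-<; +-monoʳ-≤; ≤-trans)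
  open import Data.Integer.Tactic.RingSolver using (solve-∀)
  open import Data.Product using (Σ; _×_; _,_)
  open import Function.Bundles using (_⇔_; Equivalence)
  open import Relation.Nullary using (¬_; Dec; yes; no)
  open import Relation.Binary.PropositionalEquality

  data Tally (A : Set) : ℕ → ℕ → Set where
    hit  : ∀ {c} → A → Tally A c (suc c)
    miss : ∀ {c} → ¬ A → Tally A c c

  tally : ∀ {A : Set} c → Dec A → Σ ℕ (Tally A c)
  tally c (yes a) = suc c , hit a
  tally c (no ¬a) = c , miss ¬a

  tally-resp : ∀ {A B c c′} → A ⇔ B → Tally A c c′ → Tally B c c′
  tally-resp A⇔B (hit a) = hit (Equivalence.to A⇔B a)
  tally-resp A⇔B (miss ¬a) = miss (λ b → ¬a (Equivalence.from A⇔B b))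

  tally-swap : ∀ {A B c₀ c₁ c₂} → Tally A c₀ c₁ → Tally B c₁ c₂ → Σ ℕ λ c → Tally B c₀ c × Tally A c c₂
  tally-swap (hit a) (hit b) = _ , hit b , hit a
  tally-swap (hit a) (miss ¬b) = _ , miss ¬b , hit a
  tally-swap (miss ¬a) (hit b) = _ , hit b , miss ¬a
  tally-swap (miss ¬a) (miss ¬b) = _ , miss ¬b , miss ¬a

  tally-shift : ∀ {A c c′} n → Tally A c c′ → Tally A (n ℕ.+ c) (n ℕ.+ c′)
  tally-shift {c = c} n (hit a) = subst (Tally _ (n ℕ.+ c)) (sym (ℕP.+-suc n c)) (hit a)
  tally-shift n (miss ¬a) = miss ¬a

  module _ {P : ℤ → Set} {a : ℤ} where

    snoc : ∀ {len c c′} → Count P a len c → Tally (P (a + + suc len)) c c′ → Count P a (suc len) c′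
    snoc count (hit p) = cyes count p
    snoc count (miss ¬p) = cno count ¬p

    unsnoc : ∀ {len c′} → Count P a (suc len) c′ → Σ ℕ λ c → Count P a len c × Tally (P (a + + suc len)) c c′
    unsnoc (cyes count p) = _ , count , hit p
    unsnoc (cno count ¬p) = _ , count , miss ¬p

    count-empty : ∀ {c} → Count P a 0 c → c ≡ 0
    count-empty cnil = refl

  cons : ∀ {P : ℤ → Set} {b len c₀ c} → Count P (b + + 1) len c₀ → Tally (P (b + + 1)) c₀ c → Count P b (suc len) c
  cons cnil t = snoc cnil t
  cons {P} {b} {suc len} count t with unsnoc count
  ... | _ , count′ , t-top with tally-swap t-top t
  ...   | _ , t₁ , t₂ = snoc (cons count′ t₁) (subst (λ x → Tally (P x) _ _) (+-assoc b (+ 1) (+ suc len)) t₂)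

  append : ∀ {P : ℤ → Set} {a l₁ l₂ c₁ c₂} → Count P a l₁ c₁ → Count P (a + + l₁) l₂ c₂ →
           Count P a (l₁ ℕ.+ l₂) (c₁ ℕ.+ c₂)
  append {P} {a} {l₁} {c₁ = c₁} count₁ cnil =
    subst₂ (Count P a) (sym (ℕP.+-identityʳ l₁)) (sym (ℕP.+-identityʳ c₁)) count₁
  append {P} {a} {l₁} {suc l₂} {c₁ = c₁} {c₂} count₁ count₂ with unsnoc count₂
  ... | c₂′ , count₂′ , t = subst (λ l → Count P a l (c₁ ℕ.+ c₂)) (sym (ℕP.+-suc l₁ l₂))
                              (snoc (append count₁ count₂′) (tally-shift c₁ (subst (λ x → Tally (P x) c₂′ c₂) point t)))
    where
      point : a + + l₁ + + suc l₂ ≡ a + + suc (l₁ ℕ.+ l₂)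
      point = trans (+-assoc a (+ l₁) (+ suc l₂)) (cong (λ l → a + + l) (ℕP.+-suc l₁ l₂))

  InWindow : ℤ → ℕ → ℤ → Set
  InWindow a len x = a < x × x ≤ a + + len

  top-in-window : ∀ a len → InWindow a (suc len) (a + + suc len)
  top-in-window a len = subst (_< a + + suc len) (+-identityʳ a) (+-monoʳ-< a (+<+ (ℕ.s≤s ℕ.z≤n))) ,
                        +-monoʳ-≤ a (+≤+ ℕP.≤-refl)

  widen-window : ∀ {a len x} → InWindow a len x → InWindow a (suc len) x
  widen-window {a} {len} (a<x , x≤) = a<x , ≤-trans x≤ (+-monoʳ-≤ a (+≤+ (ℕP.n≤1+n len)))

  module _ {P Q : ℤ → Set} where

    translate : ∀ {a b d len c} → Count P a len c → b ≡ d + a →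
                (∀ x → InWindow a len x → P x ⇔ Q (d + x)) → Count Q b len c
    translate cnil _ _ = cnil
    translate {a} {b} {d} {suc len} {c} count b≡ P⇔Q with unsnoc count
    ... | c₀ , count′ , t =
      snoc (translate {d = d} count′ b≡ (λ x w → P⇔Q x (widen-window w)))
           (subst (λ x → Tally (Q x) c₀ c) point (tally-resp (P⇔Q _ (top-in-window a len)) t))
      where
        point : d + (a + + suc len) ≡ b + + suc len
        point = trans (sym (+-assoc d a _)) (cong (_+ + suc len) (sym b≡))

    -- A count is preserved by a reflection x ↦ d - x respecting the predicates;
    -- the top point of the source becomes the bottom point of the target.
    reflect : ∀ {a b d len c} → Count P a len c → b + + suc len ≡ d - a →
              (∀ x → InWindow a len x → P x ⇔ Q (d - x)) → Count Q b len c
    reflect cnil _ _ = cnil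
    reflect {a} {b} {d} {suc len} {c} count b≡ P⇔Q with unsnoc count
    ... | c₀ , count′ , t =
      cons (reflect {d = d} count′ (trans (+-assoc b (+ 1) (+ suc len)) b≡) (λ x w → P⇔Q x (widen-window w)))
           (subst (λ x → Tally (Q x) c₀ c) point (tally-resp (P⇔Q _ (top-in-window a len)) t))
      where
        open ≡-Reasoning
        split : ∀ d a s → d - (a + s) ≡ (d - a) - s
        split = solve-∀
        cancel : ∀ b o s → (b + (o + s)) - s ≡ b + o
        cancel = solve-∀
        point : d - (a + + suc len) ≡ b + + 1
        point = begin
            d - (a + + suc len)                  ≡⟨ split d a (+ suc len) ⟩
            (d - a) - + suc len                  ≡⟨ cong (_- + suc len) (sym b≡) ⟩
            (b + (+ 1 + + suc len)) - + suc len  ≡⟨ cancel b (+ 1) (+ suc len) ⟩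
            b + + 1                              ∎

module FarDifference (k : ℕ) where

  open Skipponacci k
  open import Data.Nat as ℕ using (ℕ; zero; suc; _∸_; s≤s; z≤n; ∣_-_∣)
  import Data.Nat.Properties as ℕP
  open import Data.Integer as ℤ using (ℤ; +_; -_; _+_; _-_; _<_; _≤_; +≤+)
  import Data.Integer.Properties as ℤP
  open import Data.Integer.Tactic.RingSolver using (solve-∀)
  open import Data.Bool using (Bool; true; false; not)
  open import Data.List using (List; []; _∷_; map; length)
  open import Data.List.Relation.Unary.All as All using (All; []; _∷_)
  import Data.List.Relation.Unary.All.Properties as AllP
  open import Data.List.Relation.Unary.AllPairs as AllPairs using (AllPairs; []; _∷_)
  import Data.List.Relation.Unary.AllPairs.Properties as AllPairsP
  open import Data.List.Relation.Binary.Permutation.Propositional using (_↭_; prep; swap; ↭-sym; ↭-trans; ↭⇒↭ₛ)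
  import Data.List.Relation.Binary.Permutation.Propositional as Perm
  open import Data.List.Relation.Binary.Permutation.Propositional.Properties using (All-resp-↭; filter-↭; ↭-length)
  import Data.List.Relation.Binary.Permutation.Setoid.Properties as SetoidPerm
  open import Data.Product using (Σ; _×_; _,_; proj₁; proj₂)
  open import Data.Empty using (⊥-elim)
  open import Function.Bundles using (_⇔_; mk⇔)
  open import Relation.Nullary using (Dec; yes; no)
  open import Relation.Binary.PropositionalEquality
  open ≡-Reasoning

  index : Term → ℕ
  index = proj₂

  term-value : Term → ℤ
  term-value (true , i) = + S k i
  term-value (false , i) = - + S k i

  value-cons : ∀ t L → value k (t ∷ L) ≡ term-value t + value k L
  value-cons (true , i) L = refl
  value-cons (false , i) L = refl

  gap : Bool → Bool → ℕ
  gap true  true  = wide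
  gap false false = wide
  gap true  false = narrow
  gap false true  = narrow

  wide≡2+k+k : wide ≡ 2 ℕ.+ (k ℕ.+ k)
  wide≡2+k+k = cong (λ z → 2 ℕ.+ (k ℕ.+ z)) (ℕP.+-identityʳ k)

  Apart⇒gap : ∀ s t i j → Apart k (s , i) (t , j) → gap s t ℕ.≤ ∣ i - j ∣
  Apart⇒gap true  true  i j h = subst (ℕ._≤ ∣ i - j ∣) (sym wide≡2+k+k) h
  Apart⇒gap true  false i j h = h
  Apart⇒gap false true  i j h = h
  Apart⇒gap false false i j h = subst (ℕ._≤ ∣ i - j ∣) (sym wide≡2+k+k) h

  gap⇒Apart : ∀ s t i j → gap s t ℕ.≤ ∣ i - j ∣ → Apart k (s , i) (t , j)
  gap⇒Apart true  true  i j h = subst (ℕ._≤ ∣ i - j ∣) wide≡2+k+k h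
  gap⇒Apart true  false i j h = h
  gap⇒Apart false true  i j h = h
  gap⇒Apart false false i j h = subst (ℕ._≤ ∣ i - j ∣) wide≡2+k+k h

  Apart-sym : ∀ x y → Apart k x y → Apart k y x
  Apart-sym (s , i) (t , j) h =
    gap⇒Apart t s j i (subst₂ ℕ._≤_ (gap-sym s t) (ℕP.∣-∣-comm i j) (Apart⇒gap s t i j h))
    where
      gap-sym : ∀ s t → gap s t ≡ gap t s
      gap-sym true  true  = refl
      gap-sym true  false = refl
      gap-sym false true  = refl
      gap-sym false false = refl

  value-↭ : ∀ {L M} → L ↭ M → value k L ≡ value k M
  value-↭ Perm.refl = refl
  value-↭ {x ∷ L} {.x ∷ M} (prep x p) = begin
      value k (x ∷ L)             ≡⟨ value-cons x L ⟩
      term-value x + value k L    ≡⟨ cong (_+_ (term-value x)) (value-↭ p) ⟩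
      term-value x + value k M    ≡⟨ sym (value-cons x M) ⟩
      value k (x ∷ M)             ∎
  value-↭ {x ∷ y ∷ L} {.y ∷ .x ∷ M} (swap x y p) = begin
      value k (x ∷ y ∷ L)                          ≡⟨ value-cons₂ x y L ⟩
      term-value x + (term-value y + value k L)    ≡⟨ cong (λ z → term-value x + (term-value y + z)) (value-↭ p) ⟩
      term-value x + (term-value y + value k M)    ≡⟨ exchange (term-value x) (term-value y) (value k M) ⟩
      term-value y + (term-value x + value k M)    ≡⟨ sym (value-cons₂ y x M) ⟩
      value k (y ∷ x ∷ M)                          ∎
    where
      value-cons₂ : ∀ x y L → value k (x ∷ y ∷ L) ≡ term-value x + (term-value y + value k L)
      value-cons₂ x y L = trans (value-cons x (y ∷ L)) (cong (_+_ (term-value x)) (value-cons y L))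
      exchange : ∀ a b c → a + (b + c) ≡ b + (a + c)
      exchange = solve-∀
  value-↭ (Perm.trans p q) = trans (value-↭ p) (value-↭ q)

  FarDiff-↭ : ∀ {L M} → L ↭ M → FarDiff k L → FarDiff k M
  FarDiff-↭ p (indices , apart) =
    All-resp-↭ p indices , SetoidPerm.AllPairs-resp-↭ (setoid Term) (Apart-sym _ _) (resp₂ (Apart k)) (↭⇒↭ₛ p) apart

  npos-↭ : ∀ {L M} → L ↭ M → npos L ≡ npos M
  npos-↭ p = ↭-length (filter-↭ _ p)

  nneg-↭ : ∀ {L M} → L ↭ M → nneg L ≡ nneg M
  nneg-↭ p = ↭-length (filter-↭ _ p)

  flip : Term → Term
  flip (s , i) = (not s , i)

  negate : List Term → List Term
  negate = map flip

  value-negate : ∀ L → value k (negate L) ≡ - value k L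
  value-negate [] = refl
  value-negate ((true , i) ∷ L) = begin
      - + S k i + value k (negate L)   ≡⟨ cong (_+_ (- + S k i)) (value-negate L) ⟩
      - + S k i + - value k L          ≡⟨ sym (ℤP.neg-distrib-+ (+ S k i) (value k L)) ⟩
      - (+ S k i + value k L)          ∎
  value-negate ((false , i) ∷ L) = begin
      + S k i + value k (negate L)     ≡⟨ cong₂ _+_ (sym (ℤP.neg-involutive (+ S k i))) (value-negate L) ⟩
      - - + S k i + - value k L        ≡⟨ sym (ℤP.neg-distrib-+ (- + S k i) (value k L)) ⟩
      - (- + S k i + value k L)        ∎

  npos-negate : ∀ L → npos (negate L) ≡ nneg L
  npos-negate [] = refl
  npos-negate ((true , i) ∷ L) = npos-negate L
  npos-negate ((false , i) ∷ L) = cong suc (npos-negate L)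

  nneg-negate : ∀ L → nneg (negate L) ≡ npos L
  nneg-negate [] = refl
  nneg-negate ((true , i) ∷ L) = cong suc (nneg-negate L)
  nneg-negate ((false , i) ∷ L) = nneg-negate L

  FarDiff-negate : ∀ {L} → FarDiff k L → FarDiff k (negate L)
  FarDiff-negate (indices , apart) = AllP.map⁺ indices ,
                                     AllPairsP.map⁺ (AllPairs.map (λ {x} {y} → Apart-flip x y) apart)
    where
      Apart-flip : ∀ x y → Apart k x y → Apart k (flip x) (flip y)
      Apart-flip (true , i)  (true , j)  h = h
      Apart-flip (true , i)  (false , j) h = h
      Apart-flip (false , i) (true , j)  h = h
      Apart-flip (false , i) (false , j) h = h

  HasFDR-negate : ∀ {x m ℓ} → HasFDR k x m ℓ → HasFDR k (- x) ℓ m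
  HasFDR-negate (L , far , val , pos , neg) =
    negate L , FarDiff-negate far , trans (value-negate L) (cong -_ val) ,
    trans (cong +_ (npos-negate L)) neg , trans (cong +_ (nneg-negate L)) pos

  HasFDR-negate⇔ : ∀ {x m ℓ} → HasFDR k (- x) m ℓ ⇔ HasFDR k x ℓ m
  HasFDR-negate⇔ {x} = mk⇔ (λ h → subst (λ y → HasFDR k y _ _) (ℤP.neg-involutive x) (HasFDR-negate h)) HasFDR-negate

  Window : ℕ → ℤ → Set
  Window j x = + R k j < x × x ≤ + R k (suc j)

  window-positive : ∀ {j x} → Window j x → + 0 < x
  window-positive (lo , _) = ℤP.≤-<-trans (+≤+ z≤n) lo

  -- Values ranging over [-R_k(b false), R_k(b true)]: the bounds reached by
  -- representations whose positive (negative) indices are at most b true (b false).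
  RangeBy : (Bool → ℕ) → ℤ → Set
  RangeBy b x = - + R k (b false) ≤ x × x ≤ + R k (b true)

  range-negate : ∀ {b x} → RangeBy b x → RangeBy (λ t → b (not t)) (- x)
  range-negate {x = x} (lo , hi) = ℤP.neg-mono-≤ hi , subst (- x ≤_) (ℤP.neg-involutive _) (ℤP.neg-mono-≤ lo)

  range-mono : ∀ {b b′ x} → (∀ t → b t ℕ.≤ b′ t) → RangeBy b x → RangeBy b′ x
  range-mono b≤b′ (lo , hi) = ℤP.≤-trans (ℤP.neg-mono-≤ (+≤+ (R-mono (b≤b′ false)))) lo ,
                              ℤP.≤-trans hi (+≤+ (R-mono (b≤b′ true)))

  -- The admissible values of the summands following a leading +S_n.
  Centred : ℕ → ℤ → Set
  Centred n = RangeBy (λ t → n ∸ gap true t)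

  centred-suc : ∀ {n v} → Centred n v → Centred (suc n) v
  centred-suc {n} = range-mono (λ t → ℕP.∸-monoˡ-≤ (gap true t) (ℕP.n≤1+n n))

  S-via-Rℤ : ∀ j → + S k (suc j) ≡ + R k j + + R k (j ∸ suc k) + + 1
  S-via-Rℤ j = trans (cong +_ (S-via-R j)) (trans (ℤP.pos-+ _ 1) (cong (_+ + 1) (ℤP.pos-+ (R k j) _)))

  window-low-end : ∀ j → + suc (R k j) ≡ + S k (suc j) - + R k (suc j ∸ narrow)
  window-low-end j = begin
      + suc (R k j)                                          ≡⟨ cancel (+ R k j) (+ R k (j ∸ suc k)) ⟩
      + R k j + + R k (j ∸ suc k) + + 1 - + R k (j ∸ suc k)  ≡⟨ cong (_- + R k (j ∸ suc k)) (sym (S-via-Rℤ j)) ⟩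
      + S k (suc j) - + R k (suc j ∸ narrow)                 ∎
    where
      cancel : ∀ r q → + 1 + r ≡ r + q + + 1 - q
      cancel = solve-∀

  window-high-end : ∀ j → + R k (suc j) ≡ + S k (suc j) + + R k (suc j ∸ wide)
  window-high-end j = trans (cong +_ (R-step (suc j))) (ℤP.pos-+ (S k (suc j)) _)

  centred⇒window : ∀ j v → Centred (suc j) v → Window j (+ S k (suc j) + v)
  centred⇒window j v (lo , hi) =
    ℤP.suc[i]≤j⇒i<j (subst (_≤ + S k (suc j) + v) (sym (window-low-end j)) (ℤP.+-monoʳ-≤ (+ S k (suc j)) lo)) ,
    subst (+ S k (suc j) + v ≤_) (sym (window-high-end j)) (ℤP.+-monoʳ-≤ (+ S k (suc j)) hi)

  window⇒centred : ∀ j x → Window j x → Centred (suc j) (x - + S k (suc j))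
  window⇒centred j x (lo , hi) =
    subst (_≤ x - Sn) low (ℤP.+-monoˡ-≤ (- Sn) (ℤP.i<j⇒suc[i]≤j lo)) ,
    subst (x - Sn ≤_) high (ℤP.+-monoˡ-≤ (- Sn) hi)
    where
      Sn = + S k (suc j)
      low : + suc (R k j) - Sn ≡ - + R k (suc j ∸ narrow)
      low = trans (cong (_- Sn) (window-low-end j)) (cancel Sn _)
        where
          cancel : ∀ s q → s - q - s ≡ - q
          cancel = solve-∀
      high : + R k (suc j) - Sn ≡ + R k (suc j ∸ wide)
      high = trans (cong (_- Sn) (window-high-end j)) (cancel Sn _)
        where
          cancel : ∀ s w → s + w - s ≡ w
          cancel = solve-∀

  signed : Bool → ℤ → ℤ
  signed true  x = x
  signed false x = - x

  window⇒range : ∀ {b} s j x → Window j (signed s x) → suc j ℕ.≤ b s → RangeBy b x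
  window⇒range true j x w j<b =
    ℤP.≤-trans ℤP.neg-≤-pos (ℤP.<⇒≤ (window-positive {j} w)) ,
    ℤP.≤-trans (proj₂ w) (+≤+ (R-mono j<b))
  window⇒range false j x w j<b =
    subst (_ ≤_) (ℤP.neg-involutive x) (ℤP.neg-mono-≤ (ℤP.≤-trans (proj₂ w) (+≤+ (R-mono j<b)))) ,
    ℤP.≤-trans (subst (_≤ + 0) (ℤP.neg-involutive x) (ℤP.neg-mono-≤ (ℤP.<⇒≤ (window-positive {j} w)))) (+≤+ z≤n)

  window-unique : ∀ {i j x} → Window i x → Window j x → i ≡ j
  window-unique {i} {j} (lo-i , hi-i) (lo-j , hi-j) =
    ℕP.≤-antisym (ℕP.≤-pred (below {i} {j} lo-i hi-j)) (ℕP.≤-pred (below {j} {i} lo-j hi-i))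
    where
      below : ∀ {a b x} → + R k a < x → x ≤ + R k (suc b) → a ℕ.< suc b
      below lo hi = R-cancel-< (ℤP.drop‿+<+ (ℤP.<-≤-trans lo hi))

  Bounded : (Bool → ℕ) → List Term → Set
  Bounded b = All (λ t → index t ℕ.≤ b (proj₁ t))

  gap⇒room : ∀ {d i j} → i ℕ.≤ j → d ℕ.≤ ∣ j - i ∣ → i ℕ.≤ j ∸ d
  gap⇒room {d} {i} {j} i≤j d≤ =
    ℕP.m+n≤o⇒m≤o∸n i (subst (ℕ._≤ j) (ℕP.+-comm d i)
      (ℕP.m≤o∸n⇒m+n≤o d i≤j (subst (d ℕ.≤_) (ℕP.m≤n⇒∣n-m∣≡n∸m i≤j) d≤)))

  room⇒gap : ∀ {d i j} → 1 ℕ.≤ i → i ℕ.≤ j ∸ d → d ℕ.≤ ∣ j - i ∣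
  room⇒gap {d} {i} {j} i≥1 i≤ with d ℕ.≤? j
  ... | no d≰j = ⊥-elim (ℕP.<⇒≱ i≥1 (ℕP.≤-trans i≤ (ℕP.≤-reflexive j∸d≡0)))
    where j∸d≡0 = ℕP.m≤n⇒m∸n≡0 (ℕP.<⇒≤ (ℕP.≰⇒> d≰j))
  ... | yes d≤j = subst (d ℕ.≤_) (sym (ℕP.m≤n⇒∣n-m∣≡n∸m (ℕP.m+n≤o⇒m≤o i i+d≤j)))
                        (ℕP.m+n≤o⇒m≤o∸n d (subst (ℕ._≤ j) (ℕP.+-comm i d) i+d≤j))
    where
      i+d≤j = ℕP.m≤o∸n⇒m+n≤o i d≤j i≤

  select-max : ∀ x L → Σ Term λ y → Σ (List Term) λ rest →
               (x ∷ L ↭ y ∷ rest) × All (λ t → index t ℕ.≤ index y) rest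
  select-max x [] = x , [] , Perm.refl , []
  select-max x (z ∷ L) with select-max z L
  ... | y , rest , p , below with index x ℕ.≤? index y
  ...   | yes x≤y = y , x ∷ rest , ↭-trans (prep x p) (swap x y Perm.refl) , x≤y ∷ below
  ...   | no x≰y = x , z ∷ L , Perm.refl , All-resp-↭ (↭-sym p) (y≤x ∷ All.map (λ t≤y → ℕP.≤-trans t≤y y≤x) below)
    where y≤x = ℕP.<⇒≤ (ℕP.≰⇒> x≰y)

  record Leading (L : List Term) : Set where
    field
      sign       : Bool
      level      : ℕ
      rest       : List Term
      perm       : L ↭ (sign , suc level) ∷ rest
      rest-far   : FarDiff k rest
      rest-bound : Bounded (λ t → suc level ∸ gap sign t) rest

  leading : ∀ x L → FarDiff k (x ∷ L) → Leading (x ∷ L)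
  leading x L far with select-max x L
  ... | (s , zero) , rest , p , below with FarDiff-↭ p far
  ...   | (() ∷ _) , _
  leading x L far | (s , suc l) , rest , p , below with FarDiff-↭ p far
  ...   | (_ ∷ indices) , (apart ∷ aparts) = record
    { sign = s ; level = l ; rest = rest ; perm = p ; rest-far = indices , aparts
    ; rest-bound = All.zipWith (λ { {t , i} (i≤ , ap) → gap⇒room i≤ (Apart⇒gap s t (suc l) i ap) }) (below , apart)
    }

  extend : ∀ s n rest → FarDiff k rest → Bounded (λ t → suc n ∸ gap s t) rest → FarDiff k ((s , suc n) ∷ rest)
  extend s n rest (indices , aparts) bound =
    (s≤s z≤n ∷ indices) ,
    (All.zipWith (λ { {t , i} (i≥1 , i≤) → gap⇒Apart s t (suc n) i (room⇒gap i≥1 i≤) }) (indices , bound) ∷ aparts)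

  module _ {L : List Term} (ld : Leading L) where
    open Leading ld

    value-leading : value k L ≡ term-value (sign , suc level) + value k rest
    value-leading = trans (value-↭ perm) (value-cons (sign , suc level) rest)

    leading-window : RangeBy (λ t → suc level ∸ gap sign t) (value k rest) →
                     Window level (signed sign (value k L))
    leading-window range =
      subst (Window level) (sym (trans (cong (signed sign) value-leading) (signed-term sign)))
            (centred⇒window level _ (signed-centred sign range))
      where
        signed-term : ∀ s → signed s (term-value (s , suc level) + value k rest) ≡ + S k (suc level) + signed s (value k rest)
        signed-term true = refl
        signed-term false = trans (ℤP.neg-distrib-+ (- + S k (suc level)) _)
                                  (cong (_+ - value k rest) (ℤP.neg-involutive (+ S k (suc level))))
        signed-centred : ∀ s {v} → RangeBy (λ t → suc level ∸ gap s t) v → Centred (suc level) (signed s v)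
        signed-centred true r = r
        signed-centred false r = range-negate {b = λ t → suc level ∸ gap false t} r

  value-bound : ∀ {b} L → FarDiff k L → Bounded b L → RangeBy b (value k L)
  value-bound L = bound-by-length (length L) L ℕP.≤-refl
    where
      bound-by-length : ∀ N {b} L → length L ℕ.≤ N → FarDiff k L → Bounded b L → RangeBy b (value k L)
      bound-by-length N [] _ _ _ = ℤP.neg-≤-pos , +≤+ z≤n
      bound-by-length (suc N) {b} (x ∷ L) (s≤s len≤) far bound =
        window⇒range {b} sign level _ (leading-window ld rest-range) top≤b
        where
          ld = leading x L far
          open Leading ld
          rest-range = bound-by-length N rest (ℕP.≤-trans (ℕP.≤-reflexive (ℕP.suc-injective (sym (↭-length perm)))) len≤)
                                       rest-far rest-bound
          top≤b : suc level ℕ.≤ b sign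
          top≤b with All-resp-↭ perm bound
          ... | t≤ ∷ _ = t≤

  window-of-leading : ∀ {L} (ld : Leading L) → Window (Leading.level ld) (signed (Leading.sign ld) (value k L))
  window-of-leading ld = leading-window ld (value-bound rest rest-far rest-bound)
    where open Leading ld

  HasFDR-zero : ∀ {m ℓ} → HasFDR k (+ 0) m ℓ → m ≡ + 0 × ℓ ≡ + 0
  HasFDR-zero ([] , _ , _ , pos , neg) = sym pos , sym neg
  HasFDR-zero (x ∷ L , far , val , _ , _) =
    ⊥-elim (ℤP.<-irrefl (sym (trans (cong (signed sign) val) (signed-zero sign))) (window-positive {level} (window-of-leading ld)))
    where
      ld = leading x L far
      open Leading ld
      signed-zero : ∀ s → signed s (+ 0) ≡ + 0
      signed-zero true = refl
      signed-zero false = refl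

  HasFDR-zero? : ∀ m ℓ → Dec (HasFDR k (+ 0) m ℓ)
  HasFDR-zero? m ℓ with m ℤ.≟ + 0 | ℓ ℤ.≟ + 0
  ... | yes refl | yes refl = yes ([] , ([] , []) , refl , refl , refl)
  ... | no m≢0 | _ = no (λ h → m≢0 (proj₁ (HasFDR-zero h)))
  ... | yes _ | no ℓ≢0 = no (λ h → ℓ≢0 (proj₂ (HasFDR-zero h)))

  top-summand : ∀ j L → FarDiff k L → Window j (value k L) →
                Σ (List Term) λ rest → (L ↭ (true , suc j) ∷ rest) × FarDiff k rest
  top-summand j [] _ w = ⊥-elim (ℤP.<-irrefl refl (window-positive {j} w))
  top-summand j (x ∷ L) far w with leading x L far | window-of-leading (leading x L far)
  ... | record { sign = true ; level = l ; rest = rest ; perm = p ; rest-far = rf } | w′ with window-unique {l} {j} w′ w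
  ...   | refl = rest , p , rf
  top-summand j (x ∷ L) far w | record { sign = false ; level = l } | w′ =
    ⊥-elim (ℤP.<-asym (window-positive {j} w) (subst (_< + 0) (ℤP.neg-involutive _) (ℤP.neg-mono-< (window-positive {l} w′))))

  range⇒bounded : ∀ {b} L → FarDiff k L → RangeBy b (value k L) →
                  b true ∸ narrow ℕ.≤ b false → b false ∸ narrow ℕ.≤ b true → Bounded b L
  range⇒bounded [] _ _ _ _ = []
  range⇒bounded {b} (x ∷ L) far range tf ft =
    All-resp-↭ (↭-sym perm) (top≤ ∷ All.map (λ {t} → follow (proj₁ t)) rest-bound)
    where
      ld = leading x L far
      open Leading ld
      signed-upper : ∀ s → signed s (value k (x ∷ L)) ≤ + R k (b s)
      signed-upper true = proj₂ range
      signed-upper false = subst (_ ≤_) (ℤP.neg-involutive _) (ℤP.neg-mono-≤ (proj₁ range))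
      top≤ : suc level ℕ.≤ b sign
      top≤ = R-cancel-< (ℤP.drop‿+<+ (ℤP.<-≤-trans (proj₁ (window-of-leading ld)) (signed-upper sign)))
      follow : ∀ t {i} → i ℕ.≤ suc level ∸ gap sign t → i ℕ.≤ b t
      follow t i≤ = ℕP.≤-trans i≤ (cross sign t top≤)
        where
          cross : ∀ s t → suc level ℕ.≤ b s → suc level ∸ gap s t ℕ.≤ b t
          cross true  true  ≤b = ℕP.≤-trans (ℕP.m∸n≤m _ wide) ≤b
          cross false false ≤b = ℕP.≤-trans (ℕP.m∸n≤m _ wide) ≤b
          cross true  false ≤b = ℕP.≤-trans (ℕP.∸-monoˡ-≤ narrow ≤b) tf
          cross false true  ≤b = ℕP.≤-trans (ℕP.∸-monoˡ-≤ narrow ≤b) ft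

  HasFDR-leading : ∀ j v {m ℓ} → Centred (suc j) v →
                   HasFDR k (+ S k (suc j) + v) m ℓ ⇔ HasFDR k v (m - + 1) ℓ
  HasFDR-leading j v {m} {ℓ} centred = mk⇔ remove add
    where
      Sn = + S k (suc j)

      remove : HasFDR k (Sn + v) m ℓ → HasFDR k v (m - + 1) ℓ
      remove (L , far , val , pos , neg)
        with top-summand j L far (subst (Window j) (sym val) (centred⇒window j v centred))
      ... | rest , p , rest-far =
        rest , rest-far , cancelˡ (trans (sym (value-↭ p)) val) ,
        cong (_- + 1) (trans (cong +_ (sym (npos-↭ p))) pos) , trans (cong +_ (sym (nneg-↭ p))) neg
        where
          cancelˡ : ∀ {a b} → Sn + a ≡ Sn + b → a ≡ b
          cancelˡ {a} {b} eq = trans (sub Sn a) (trans (cong (_- Sn) eq) (sym (sub Sn b)))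
            where
              sub : ∀ s x → x ≡ s + x - s
              sub = solve-∀

      add : HasFDR k v (m - + 1) ℓ → HasFDR k (Sn + v) m ℓ
      add (L , far , val , pos , neg) =
        (true , suc j) ∷ L , extend true j L far bound , cong (_+_ Sn) val ,
        trans (cong (_+_ (+ 1)) pos) (restore m) , neg
        where
          bound = range⇒bounded L far (subst (Centred (suc j)) (sym val) centred)
                    (ℕP.≤-trans (ℕP.m∸n≤m _ narrow) (ℕP.∸-monoʳ-≤ (suc j) narrow≤wide))
                    (ℕP.≤-trans (ℕP.≤-reflexive (ℕP.∸-+-assoc (suc j) narrow narrow)) (ℕP.∸-monoʳ-≤ (suc j) wide≤2narrow))
            where
              narrow≤wide : narrow ℕ.≤ wide
              narrow≤wide = s≤s (s≤s (ℕP.m≤m+n k _))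
              wide≤2narrow : wide ℕ.≤ narrow ℕ.+ narrow
              wide≤2narrow = s≤s (s≤s (ℕP.≤-trans (ℕP.+-monoʳ-≤ k (ℕP.≤-reflexive (ℕP.+-identityʳ k)))
                                                   (ℕP.+-monoʳ-≤ k (ℕP.m≤n+m k 2))))
          restore : ∀ m → + 1 + (m - + 1) ≡ m
          restore = solve-∀

module Recurrence (k : ℕ) where

  open Skipponacci k
  open FarDifference k
  open Counting
  open import Data.Nat as ℕ using (ℕ; zero; suc; _∸_; s≤s; z≤n)
  import Data.Nat.Properties as ℕP
  open import Data.Integer as ℤ using (ℤ; +_; -_; _+_; _-_; _<_; _≤_; +≤+)
  import Data.Integer.Properties as ℤP
  open import Data.Integer.Tactic.RingSolver using (solve-∀)
  open import Data.Product using (Σ; _×_; _,_; proj₁; proj₂)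
  open import Function.Bundles using (_⇔_)
  import Function.Properties.Equivalence as ⇔
  open import Data.Nat.Induction using (<-rec)
  open import Relation.Nullary using (yes; no)
  import Relation.Nullary.Decidable as Dec
  open import Relation.Binary.PropositionalEquality
  open ≡-Reasoning

  Has : ℤ → ℤ → ℤ → Set
  Has m ℓ x = HasFDR k x m ℓ

  -- Level j covers the integers in (R_k(j-1), R_k(j)] (nothing for j = 0), and
  -- LevelCount m ℓ j c says that p_{j,m,ℓ} = c.
  base : ℕ → ℤ
  base j = + R k (j ∸ 1)

  width : ℕ → ℕ
  width j = R k j ∸ R k (j ∸ 1)

  LevelCount : ℤ → ℤ → ℕ → ℕ → Set
  LevelCount m ℓ j = Count (Has m ℓ) (base j) (width j)

  width-ℤ : ∀ j → + width j ≡ + R k j - base j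
  width-ℤ j = sym (trans (ℤP.m-n≡m⊖n (R k j) (R k (j ∸ 1))) (ℤP.⊖-≥ (R-mono (ℕP.m∸n≤m j 1))))

  level-top : ∀ j → base j + + width j ≡ + R k j
  level-top j = cong +_ (ℕP.m+[n∸m]≡n (R-mono (ℕP.m∸n≤m j 1)))

  in-level : ∀ j {x} → InWindow (base j) (width j) x → + R k (j ∸ 1) < x × x ≤ + R k j
  in-level j {x} (lo , hi) = lo , subst (x ≤_) (level-top j) hi

  Has-resp : ∀ {m ℓ x y} → x ≡ y → Has m ℓ x ⇔ Has m ℓ y
  Has-resp refl = ⇔.refl

  -- The window of level n+1 = suc n₁ splits into three blocks, from the bottom up.
  -- Block 1 is level n+1-(k+2) reflected: x = S_{n+1} - w.
  block-reflected : ∀ n₁ {m ℓ w} → InWindow (base (suc n₁ ∸ narrow)) (width (suc n₁ ∸ narrow)) w →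
                    Has ℓ (m - + 1) w ⇔ Has m ℓ (+ S k (suc n₁) - w)
  block-reflected n₁ {w = w} window =
    ⇔.trans (⇔.sym HasFDR-negate⇔) (⇔.sym (HasFDR-leading n₁ (- w) centred))
    where
      centred : Centred (suc n₁) (- w)
      centred = ℤP.neg-mono-≤ (proj₂ (in-level (suc n₁ ∸ narrow) window)) ,
                ℤP.≤-trans (ℤP.neg-mono-≤ (ℤP.<⇒≤ (ℤP.≤-<-trans (+≤+ z≤n) (proj₁ window)))) (+≤+ z≤n)

  -- Block 3 is level n+1-(2k+2) shifted: x = S_{n+1} + y.
  block-shifted : ∀ n₁ {m ℓ y} → InWindow (base (suc n₁ ∸ wide)) (width (suc n₁ ∸ wide)) y →
                  Has (m - + 1) ℓ y ⇔ Has m ℓ (+ S k (suc n₁) + y)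
  block-shifted n₁ {y = y} window = ⇔.sym (HasFDR-leading n₁ y centred)
    where
      centred : Centred (suc n₁) y
      centred = ℤP.≤-trans ℤP.neg-≤-pos (ℤP.<⇒≤ (ℤP.≤-<-trans (+≤+ z≤n) (proj₁ window))) ,
                proj₂ (in-level (suc n₁ ∸ wide) window)

  -- Block 2 is level n translated: x ↦ x + S_{n+1} - S_n.
  block-translated : ∀ j {m ℓ x} → Window j x → Has m ℓ x ⇔ Has m ℓ ((+ S k (suc (suc j)) - + S k (suc j)) + x)
  block-translated j {m} {ℓ} {x} window =
    ⇔.trans (Has-resp (split Sn₁ x))
    (⇔.trans (HasFDR-leading j v centred)
    (⇔.trans (⇔.sym (HasFDR-leading (suc j) v (centred-suc {suc j} centred)))
             (Has-resp (shift Sn Sn₁ x))))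
    where
      Sn = + S k (suc (suc j))
      Sn₁ = + S k (suc j)
      v = x - Sn₁
      centred = window⇒centred j x window
      split : ∀ s x → x ≡ s + (x - s)
      split = solve-∀
      shift : ∀ s s₁ x → s + (x - s₁) ≡ (s - s₁) + x
      shift = solve-∀

  -- The arithmetic of the tiling, with A = R_k(n), B = R_k(q), C = R_k(q-1),
  -- D = R_k(n-1), E = R_k(p), F = R_k(p-1) for q = n+1-(k+2), p = n+1-(2k+2):
  -- block 1 has width B - C, block 2 width A - D, block 3 width E - F.
  layout : ∀ (A B C D E F Sn Sn₁ : ℤ) → Sn₁ ≡ D + C + + 1 → A ≡ Sn₁ + F → Sn ≡ A + B + + 1 →
           (A + (+ 1 + (B - C)) ≡ Sn - C) × (A + (B - C) ≡ (Sn - Sn₁) + D) ×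
           (A + ((B - C) + (A - D)) ≡ Sn + F) × ((B - C) + (A - D) + (E - F) ≡ (Sn + E) - A)
  layout _ B C D E F _ _ refl refl refl =
    reflected-base (D + C + + 1 + F) B C , translated-base (D + C + + 1 + F) B C D ,
    shifted-base B C D F , total B C D E F
    where
      reflected-base : ∀ A B C → A + (+ 1 + (B - C)) ≡ (A + B + + 1) - C
      reflected-base = solve-∀
      translated-base : ∀ A B C D → A + (B - C) ≡ (A + B + + 1 - (D + C + + 1)) + D
      translated-base = solve-∀
      shifted-base : ∀ B C D F → let A = D + C + + 1 + F in A + ((B - C) + (A - D)) ≡ (A + B + + 1) + F
      shifted-base = solve-∀
      total : ∀ B C D E F → let A = D + C + + 1 + F in (B - C) + (A - D) + (E - F) ≡ ((A + B + + 1) + E) - A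
      total = solve-∀

  window-ends : ∀ j → let q = suc (suc j) ∸ narrow ; p = suc (suc j) ∸ wide in
                (+ S k (suc j) ≡ + R k j + base q + + 1) × (+ R k (suc j) ≡ + S k (suc j) + base p) ×
                (+ S k (suc (suc j)) ≡ + R k (suc j) + + R k q + + 1)
  window-ends j =
    trans (S-via-Rℤ j) (cong (λ i → + R k j + + R k i + + 1) (sym q-1)) ,
    trans (window-high-end j) (cong (λ i → + S k (suc j) + + R k i) (sym p-1)) ,
    S-via-Rℤ (suc j)
    where
      q-1 : suc (suc j) ∸ narrow ∸ 1 ≡ j ∸ suc k
      q-1 = trans (ℕP.∸-+-assoc j k 1) (cong (j ∸_) (ℕP.+-comm k 1))
      p-1 : suc (suc j) ∸ wide ∸ 1 ≡ suc j ∸ wide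
      p-1 = trans (ℕP.∸-+-assoc j (2 ℕ.* k) 1) (cong (j ∸_) (ℕP.+-comm (2 ℕ.* k) 1))

  recurrence-step : ∀ j {m ℓ c₁ c₂ c₃} →
                    LevelCount m ℓ (suc j) c₁ → LevelCount (m - + 1) ℓ (suc (suc j) ∸ wide) c₂ →
                    LevelCount ℓ (m - + 1) (suc (suc j) ∸ narrow) c₃ →
                    LevelCount m ℓ (suc (suc j)) (c₁ ℕ.+ c₂ ℕ.+ c₃)
  recurrence-step j {m} {ℓ} {c₁} {c₂} {c₃} count-n count-p count-q =
    subst₂ (Count (Has m ℓ) A) total-width (reorder c₁ c₂ c₃)
      (append (append (reflect {d = Sn} count-q at-q (λ _ w → block-reflected n₁ w))
                      (translate {d = Sn - Sn₁} count-n at-n (λ x w → block-translated j (in-level (suc j) w))))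
              (translate {d = Sn} count-p at-p (λ _ w → block-shifted n₁ w)))
    where
      n₁ = suc j
      q = suc n₁ ∸ narrow
      p = suc n₁ ∸ wide
      A = + R k n₁
      Sn = + S k (suc n₁)
      Sn₁ = + S k n₁
      ends = window-ends j
      arithmetic = layout A (+ R k q) (base q) (base n₁) (+ R k p) (base p) Sn Sn₁
                     (proj₁ ends) (proj₁ (proj₂ ends)) (proj₂ (proj₂ ends))
      at-q : A + + suc (width q) ≡ Sn - base q
      at-q = trans (cong (λ w → A + (+ 1 + w)) (width-ℤ q)) (proj₁ arithmetic)
      at-n : A + + width q ≡ (Sn - Sn₁) + base n₁
      at-n = trans (cong (_+_ A) (width-ℤ q)) (proj₁ (proj₂ arithmetic))
      at-p : A + + (width q ℕ.+ width n₁) ≡ Sn + base p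
      at-p = trans (cong (_+_ A) (trans (ℤP.pos-+ (width q) _) (cong₂ _+_ (width-ℤ q) (width-ℤ n₁))))
                   (proj₁ (proj₂ (proj₂ arithmetic)))
      total-width : width q ℕ.+ width n₁ ℕ.+ width p ≡ width (suc n₁)
      total-width = ℤP.+-injective (begin
          + (width q ℕ.+ width n₁ ℕ.+ width p)
            ≡⟨ trans (ℤP.pos-+ _ (width p)) (cong (_+ + width p) (ℤP.pos-+ (width q) _)) ⟩
          + width q + + width n₁ + + width p        ≡⟨ cong₂ _+_ (cong₂ _+_ (width-ℤ q) (width-ℤ n₁)) (width-ℤ p) ⟩
          (+ R k q - base q) + (A - base n₁) + (+ R k p - base p)
                                                    ≡⟨ proj₂ (proj₂ (proj₂ arithmetic)) ⟩
          (Sn + + R k p) - A                        ≡⟨ cong (_- A) (sym (window-high-end n₁)) ⟩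
          + R k (suc n₁) - A                        ≡⟨ sym (width-ℤ (suc n₁)) ⟩
          + width (suc n₁)                          ∎)
      reorder : ∀ a b c → c ℕ.+ a ℕ.+ b ≡ a ℕ.+ b ℕ.+ c
      reorder = ℕSolver.solve-∀
        where import Data.Nat.Tactic.RingSolver as ℕSolver

  -- Level 1 is the single integer 1 = S_1, represented by +S_1 alone.
  level-one : ∀ m ℓ → Σ ℕ (LevelCount m ℓ 1)
  level-one m ℓ with tally 0 (Dec.map one⇔zero (HasFDR-zero? (m - + 1) ℓ))
    where
      one⇔zero : HasFDR k (+ 0) (m - + 1) ℓ ⇔ Has m ℓ (+ 1)
      one⇔zero = ⇔.sym (HasFDR-leading 0 (+ 0) (ℤP.neg-≤-pos {R k (1 ∸ narrow)} , +≤+ z≤n))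
  ... | c , t = c , snoc cnil t

  level-count : ∀ j m ℓ → Σ ℕ (LevelCount m ℓ j)
  level-count = <-rec (λ j → ∀ m ℓ → Σ ℕ (LevelCount m ℓ j)) by-level
    where
      by-level : ∀ j → (∀ {i} → i ℕ.< j → ∀ m ℓ → Σ ℕ (LevelCount m ℓ i)) → ∀ m ℓ → Σ ℕ (LevelCount m ℓ j)
      by-level zero _ _ _ = 0 , cnil
      by-level (suc zero) _ = level-one
      by-level (suc (suc j)) smaller m ℓ
        with smaller (ℕP.n<1+n (suc j)) m ℓ
           | smaller (s≤s (ℕP.≤-trans (ℕP.m∸n≤m j (2 ℕ.* k)) (ℕP.n≤1+n j))) (m - + 1) ℓ
           | smaller (s≤s (ℕP.≤-trans (ℕP.m∸n≤m j k) (ℕP.n≤1+n j))) ℓ (m - + 1)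
      ... | _ , count-n | _ , count-p | _ , count-q = _ , recurrence-step j count-n count-p count-q

  IsP-below : ∀ n d {m ℓ c} → LevelCount m ℓ (n ∸ d) c → IsP k (+ n - + d) m ℓ c
  IsP-below n d {m} {ℓ} {c} count = at-level (+ n - + d) (subst (λ i → LevelCount m ℓ i c) (sym (level-∸ n d)) count)
    where
      level : ℤ → ℕ
      level (+ n) = n
      level ℤ.-[1+ _ ] = 0
      level-∸ : ∀ n d → level (+ n - + d) ≡ n ∸ d
      level-∸ n d with d ℕ.≤? n
      ... | yes d≤n = cong level (trans (ℤP.m-n≡m⊖n n d) (ℤP.⊖-≥ d≤n))
      ... | no d≰n = trans (cong level (trans (ℤP.m-n≡m⊖n n d) (ℤP.⊖-< n<d)))
                           (trans (negative (ℕP.m<n⇒0<n∸m n<d)) (sym (ℕP.m≤n⇒m∸n≡0 (ℕP.<⇒≤ n<d))))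
        where
          n<d = ℕP.≰⇒> d≰n
          negative : ∀ {i} → 0 ℕ.< i → level (- + i) ≡ 0
          negative {suc i} _ = refl
      at-level : ∀ z → LevelCount m ℓ (level z) c → IsP k z m ℓ c
      at-level (+ zero) count = count-empty count
      at-level (+ suc j) count = count
      at-level ℤ.-[1+ _ ] count = count-empty count

open import Data.Nat using (ℕ; _≤_)
open import Data.Integer using (ℤ; +_; _-_; _<_)
open import Data.Product using (Σ; _×_)
open import Relation.Binary.PropositionalEquality using (_≡_)

open Skipponacci using (wide; narrow)
open Recurrence using (level-count; recurrence-step; IsP-below)
open import Data.Nat using (zero; suc; s≤s; _∸_)
open import Data.Integer using (+<+)
open import Data.Integer.Properties using (pos-*)
open import Data.Product using (_,_)
open import Relation.Binary.PropositionalEquality using (subst; cong)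

-- Theorem: p_{n,m,ℓ} = p_{n-1,m,ℓ} + p_{n-(2k+2),m-1,ℓ} + p_{n-(k+2),ℓ,m-1} for n > 1,
-- where each count exists by 'level-count' and they add up by 'recurrence-step'.
lemma3p1 : (k : ℕ) → 1 ≤ k → (n m ℓ : ℤ) → + 1 < n →
    Σ ℕ λ c₁ → Σ ℕ λ c₂ → Σ ℕ λ c₃ →
      IsP k n m ℓ (c₁ Data.Nat.+ c₂ Data.Nat.+ c₃)
      × IsP k (n - + 1) m ℓ c₁
      × IsP k (n - (+ 2 Data.Integer.+ (+ 2 Data.Integer.* + k))) (m - + 1) ℓ c₂
      × IsP k (n - (+ 2 Data.Integer.+ + k)) ℓ (m - + 1) c₃
lemma3p1 k _ (+ zero) m ℓ (+<+ ())
lemma3p1 k _ (+ suc zero) m ℓ (+<+ (s≤s ()))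
lemma3p1 k _ Data.Integer.-[1+ _ ] m ℓ ()
lemma3p1 k _ (+ suc (suc j)) m ℓ _
  with level-count k (suc j) m ℓ
     | level-count k (suc (suc j) ∸ wide k) (m - + 1) ℓ
     | level-count k (suc (suc j) ∸ narrow k) ℓ (m - + 1)
... | c₁ , count-n | c₂ , count-p | c₃ , count-q =
  c₁ , c₂ , c₃ ,
  recurrence-step k j count-n count-p count-q ,
  IsP-below k n 1 count-n ,
  subst (λ d → IsP k (+ n - d) (m - + 1) ℓ c₂) (cong (Data.Integer._+_ (+ 2)) (pos-* 2 k))
        (IsP-below k n (wide k) count-p) ,
  IsP-below k n (narrow k) count-q
  where
    n = suc (suc j)
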